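{- For $n\ge 2$, let $S$ be any set of vertices of $Q_n$ with $|S|<2^{n-1}$. If $Q_n-S$ is connected, then the diameter of $Q_n-S$ is at least $n$.
   Context: The $n$-dimensional hypercube $Q_n$ is the graph whose vertices are the binary strings of length $n$, two vertices being adjacent iff they differ in exactly one position. $Q_n-S$ denotes the subgraph obtained by deleting the vertices of $S$; the diameter is the maximum graph distance between two vertices. -}

module Defs where

open import Data.Bool using (Bool; true; false; if_then_else_)
open import Data.Nat using (ℕ; zero; suc; _+_)
open import Data.Vec using (Vec; []; _∷_)
open import Data.List using (List; []; _∷_; map; _++_; length; filter)
open import Relation.Binary.PropositionalEquality using (_≡_)
open import Relation.Nullary using (¬_)
open import Relation.Unary using (Pred)
open import Data.Bool.Properties using (T?)
open import Data.Bool using (T)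

Vertex : ℕ → Set
Vertex n = Vec Bool n

hamming : ∀ {n} → Vertex n → Vertex n → ℕ
hamming [] [] = 0
hamming (true ∷ u) (true ∷ v) = hamming u v
hamming (false ∷ u) (false ∷ v) = hamming u v
hamming (true ∷ u) (false ∷ v) = suc (hamming u v)
hamming (false ∷ u) (true ∷ v) = suc (hamming u v)

Adj : ∀ {n} → Vertex n → Vertex n → Set
Adj u v = hamming u v ≡ 1

allVertices : (n : ℕ) → List (Vertex n)
allVertices zero = [] ∷ []
allVertices (suc n) = map (true ∷_) (allVertices n) ++ map (false ∷_) (allVertices n)

VSet : ℕ → Set
VSet n = Vertex n → Bool

card : ∀ {n} → VSet n → ℕ
card {n} S = length (filter (λ v → T? (S v)) (allVertices n))

Alive : ∀ {n} → VSet n → Vertex n → Set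
Alive S v = S v ≡ false

data Walk {n : ℕ} (S : VSet n) : Vertex n → Vertex n → ℕ → Set where
  here : ∀ {u} → Alive S u → Walk S u u 0
  step : ∀ {u w v k} → Alive S u → Adj u w → Walk S w v k → Walk S u v (suc k)

Connected : ∀ {n} → VSet n → Set
Connected {n} S = (u v : Vertex n) → Alive S u → Alive S v →
  Data.Product.Σ ℕ (λ k → Walk S u v k)
  where import Data.Product

DistAtLeast : ∀ {n} → VSet n → Vertex n → Vertex n → ℕ → Set
DistAtLeast S u v d = ∀ {k} → Walk S u v k → d Data.Nat.≤ k
  where import Data.Nat

DiamAtLeast : ∀ {n} → VSet n → ℕ → Set
DiamAtLeast {n} S d = Data.Product.Σ (Vertex n) λ u → Data.Product.Σ (Vertex n) λ v →
  Alive S u Data.Product.× Alive S v Data.Product.× DistAtLeast S u v d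
  where import Data.Product

{-# OPTIONS --safe #-}
module Submission where

-- Q_n has 2^(n-1) antipodal pairs {u, ū} and each deleted vertex destroys at most one
-- of them, so fewer than 2^(n-1) deletions leave some pair intact. Every walk between
-- u and ū has length at least their Hamming distance, which is n.

open import Defs
open import Data.Nat using (ℕ; zero; suc; _+_; _*_; _^_; _∸_; _≤_; _<_; z≤n; s≤s)
open import Data.Nat.Properties
open import Data.Bool using (Bool; true; false; not)
open import Data.Bool.Properties using (T?)
open import Data.Vec using ([]; _∷_; [_])
open import Data.List using ([]; _∷_; map; _++_; length; filter)
open import Data.List.Properties using (length-++; filter-++)
open import Data.Product using (Σ-syntax; _,_; _×_)
open import Data.Sum using (_⊎_; inj₁; inj₂)
open import Function using (_∘_)
open import Relation.Nullary using (yes; no; does; contradiction)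
open import Relation.Unary using (Pred; Decidable)
open import Relation.Binary.PropositionalEquality using (_≡_; refl; cong; cong₂; subst; module ≡-Reasoning)
open import Algebra.Properties.CommutativeSemigroup +-commutativeSemigroup using (interchange)

m+n<2*o⇒m<o⊎n<o : ∀ m n o → m + n < 2 * o → m < o ⊎ n < o
m+n<2*o⇒m<o⊎n<o m n o m+n<2*o with m <? o
... | yes m<o = inj₁ m<o
... | no m≮o = inj₂ (+-cancelˡ-< o n o (begin-strict
  o + n      ≤⟨ +-monoˡ-≤ n (≮⇒≥ m≮o) ⟩
  m + n      <⟨ m+n<2*o ⟩
  2 * o      ≡⟨ cong (o +_) (+-identityʳ o) ⟩
  o + o      ∎))
  where open ≤-Reasoning

module _ {a b p} {A : Set a} {B : Set b} {P : Pred B p} (P? : Decidable P) where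

  length-filter-map : ∀ (f : A → B) xs →
    length (filter P? (map f xs)) ≡ length (filter (P? ∘ f) xs)
  length-filter-map f [] = refl
  length-filter-map f (x ∷ xs) with does (P? (f x))
  ... | true  = cong suc (length-filter-map f xs)
  ... | false = length-filter-map f xs

antipode : ∀ {n} → Vertex n → Vertex n
antipode [] = []
antipode (b ∷ u) = not b ∷ antipode u

face : ∀ {n} → VSet (suc n) → Bool → VSet n
face S b u = S (b ∷ u)

card-face : ∀ {n} (S : VSet (suc n)) → card S ≡ card (face S true) + card (face S false)
card-face {n} S = begin
  length (filter P? (map (true ∷_) vs ++ map (false ∷_) vs))
    ≡⟨ cong length (filter-++ P? (map (true ∷_) vs) (map (false ∷_) vs)) ⟩
  length (filter P? (map (true ∷_) vs) ++ filter P? (map (false ∷_) vs))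
    ≡⟨ length-++ (filter P? (map (true ∷_) vs)) ⟩
  length (filter P? (map (true ∷_) vs)) + length (filter P? (map (false ∷_) vs))
    ≡⟨ cong₂ _+_ (length-filter-map P? (true ∷_) vs) (length-filter-map P? (false ∷_) vs) ⟩
  card (face S true) + card (face S false) ∎
  where
    open ≡-Reasoning
    vs = allVertices n
    P? = λ v → T? (S v)

card-+-crossed-faces : ∀ {n} (A B : VSet (suc n)) →
  card A + card B ≡
  (card (face A true) + card (face B false)) + (card (face A false) + card (face B true))
card-+-crossed-faces A B = begin
  card A + card B                ≡⟨ cong₂ _+_ (card-face A) (card-face B) ⟩
  (a₁ + a₀) + (b₁ + b₀)          ≡⟨ cong ((a₁ + a₀) +_) (+-comm b₁ b₀) ⟩
  (a₁ + a₀) + (b₀ + b₁)          ≡⟨ interchange a₁ a₀ b₀ b₁ ⟩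
  (a₁ + b₀) + (a₀ + b₁)          ∎
  where
    open ≡-Reasoning
    a₁ = card (face A true)
    a₀ = card (face A false)
    b₁ = card (face B true)
    b₀ = card (face B false)

-- x and its antipode lie in opposite faces, so the induction pairs the faces crosswise;
-- one of the two crossed pairs inherits the counting bound.
antipodal-alive : ∀ n (A B : VSet n) → card A + card B < 2 ^ n →
  Σ[ x ∈ Vertex n ] Alive A x × Alive B (antipode x)
antipodal-alive zero A B A+B<1 with A [] in A[]≡ | B [] in B[]≡
... | false | false = [] , A[]≡ , B[]≡
... | false | true  = contradiction A+B<1 (<-irrefl refl)
... | true  | _     = contradiction A+B<1 λ { (s≤s ()) }
antipodal-alive (suc n) A B A+B<2^[1+n]
  with m+n<2*o⇒m<o⊎n<o _ _ (2 ^ n) (subst (_< 2 ^ suc n) (card-+-crossed-faces A B) A+B<2^[1+n])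
... | inj₁ bound = let x , Ax , Bx̄ = antipodal-alive n (face A true) (face B false) bound
                   in true ∷ x , Ax , Bx̄
... | inj₂ bound = let x , Ax , Bx̄ = antipodal-alive n (face A false) (face B true) bound
                   in false ∷ x , Ax , Bx̄

antipodal-pair-alive : ∀ {n} (S : VSet (suc n)) → card S < 2 ^ n →
  Σ[ u ∈ Vertex (suc n) ] Alive S u × Alive S (antipode u)
antipodal-pair-alive {n} S S<2^n
  with x , Sx , Sx̄ ← antipodal-alive n (face S true) (face S false) (subst (_< 2 ^ n) (card-face S) S<2^n)
  = true ∷ x , Sx , Sx̄

hamming-self : ∀ {n} (u : Vertex n) → hamming u u ≡ 0
hamming-self [] = refl
hamming-self (true ∷ u) = hamming-self u
hamming-self (false ∷ u) = hamming-self u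

hamming-antipode : ∀ {n} (u : Vertex n) → hamming u (antipode u) ≡ n
hamming-antipode [] = refl
hamming-antipode (true ∷ u) = cong suc (hamming-antipode u)
hamming-antipode (false ∷ u) = cong suc (hamming-antipode u)

hamming-∷ : ∀ {n} b c (u v : Vertex n) → hamming (b ∷ u) (c ∷ v) ≡ hamming [ b ] [ c ] + hamming u v
hamming-∷ true  true  u v = refl
hamming-∷ true  false u v = refl
hamming-∷ false true  u v = refl
hamming-∷ false false u v = refl

hamming-triangle-bit : ∀ b c d → hamming [ b ] [ d ] ≤ hamming [ b ] [ c ] + hamming [ c ] [ d ]
hamming-triangle-bit true  _     true  = z≤n
hamming-triangle-bit false _     false = z≤n
hamming-triangle-bit true  true  false = s≤s z≤n
hamming-triangle-bit true  false false = s≤s z≤n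
hamming-triangle-bit false true  true  = s≤s z≤n
hamming-triangle-bit false false true  = s≤s z≤n

hamming-triangle : ∀ {n} (u w v : Vertex n) → hamming u v ≤ hamming u w + hamming w v
hamming-triangle [] [] [] = z≤n
hamming-triangle (b ∷ u) (c ∷ w) (d ∷ v) = begin
  hamming (b ∷ u) (d ∷ v)                                   ≡⟨ hamming-∷ b d u v ⟩
  hamming [ b ] [ d ] + hamming u v
    ≤⟨ +-mono-≤ (hamming-triangle-bit b c d) (hamming-triangle u w v) ⟩
  (hamming [ b ] [ c ] + hamming [ c ] [ d ]) + (hamming u w + hamming w v)
    ≡⟨ interchange (hamming [ b ] [ c ]) _ (hamming u w) _ ⟩
  (hamming [ b ] [ c ] + hamming u w) + (hamming [ c ] [ d ] + hamming w v)
    ≡⟨ cong₂ _+_ (hamming-∷ b c u w) (hamming-∷ c d w v) ⟨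
  hamming (b ∷ u) (c ∷ w) + hamming (c ∷ w) (d ∷ v)        ∎
  where open ≤-Reasoning

hamming≤walk-length : ∀ {n} {S : VSet n} {u v k} → Walk S u v k → hamming u v ≤ k
hamming≤walk-length {u = u} (here _) = ≤-reflexive (hamming-self u)
hamming≤walk-length {u = u} {v} {suc k} (step {w = w} _ u~w walk) = begin
  hamming u v                  ≤⟨ hamming-triangle u w v ⟩
  hamming u w + hamming w v    ≡⟨ cong (_+ hamming w v) u~w ⟩
  suc (hamming w v)            ≤⟨ s≤s (hamming≤walk-length walk) ⟩
  suc k                        ∎
  where open ≤-Reasoning

lemma2p7 : (n : ℕ) → 2 ≤ n → (S : VSet n) → card S < 2 ^ (n ∸ 1) →
    Connected S → DiamAtLeast S n
lemma2p7 (suc n) _ S S<2^n _ with u , Su , Sū ← antipodal-pair-alive S S<2^n =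
  u , antipode u , Su , Sū , λ {k} walk → subst (_≤ k) (hamming-antipode u) (hamming≤walk-length walk)
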